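{- Let $P=(\mathcal{S},\vec{T}_U,\vec{T}_Q)$ and $P'=(\mathcal{S}',\vec{T}_U',\vec{T}_Q')$ be database-driven programs with $|\vec T_U'|\ge|\vec T_U|$ and $|\vec T_Q'|\ge|\vec T_Q|$. If there exists a projectively sufficient and inductive simulation invariant $\Phi$ for $P$ and $P'$, then $P'\preceq P$.
   Context: A database-driven program is a triple $P=(\mathcal{S},\vec{T}_U,\vec{T}_Q)$. The schema $\mathcal{S}$ maps finitely many relation names $R$ to record types $\{a_1:\tau_1;\dots;a_n:\tau_n\}$. $\vec{T}_U=(U_1,\dots,U_m)$ is a list of update transactions $\lambda\vec v.\,U$ and $\vec{T}_Q=(Q_1,\dots,Q_l)$ a list of query transactions $\lambda\vec v.\,Q$, with $U ::= \mathtt{ins}(R,\{a_1:v_1,\dots,a_n:v_n\}) \mid \mathtt{del}(R,\phi)\mid \mathtt{upd}(R,\phi,a,v)\mid U;U$, $Q ::= R\mid \Pi_\psi(Q)\mid \sigma_\phi(Q)\mid Q\bowtie_\phi Q\mid Q\cup Q\mid Q-Q$, where $\psi$ is a nonempty list of attributes, $\phi$ is a boolean combination ($\wedge,\vee,\neg$) of atoms $a\odot a'$, $a\odot v$, $a\in Q$ with $\odot\in\{\le,<,=,\ne,>,\ge\}$, and $v$ ranges over parameter variables and constants. A database instance $\Delta$ maps each relation name to a finite list of tuples; a tuple is a finite map from attribute names to values, viewed as a list of (attribute, value) pairs. A valuation $\sigma$ maps parameter variables to values; $v[\sigma]$ is the value of $v$. Semantics of updates: $[\![U_1;U_2]\!]_{\sigma,\Delta}=[\![U_2]\!]_{\sigma,[\![U_1]\!]_{\sigma,\Delta}}$;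 $\mathtt{ins}(R,t)$ appends the tuple $t[\sigma]$ to the end of $\Delta(R)$; $\mathtt{del}(R,\phi)$ replaces $\Delta(R)$ by the sublist (order preserved) of tuples $x$ with $[\![\phi]\!]_{\sigma,\Delta,x}$ false; $\mathtt{upd}(R,\phi,a,v)$ replaces $\Delta(R)$ by the list of tuples not satisfying $\phi$ (in order) followed by the list of tuples satisfying $\phi$ (in order), each with attribute $a$ set to $v[\sigma]$. Semantics of queries: $[\![R]\!]_{\sigma,\Delta}=\Delta(R)$; $\Pi_\psi$ restricts each tuple to the attributes in $\psi$; $\sigma_\phi$ keeps the tuples $x$ with $[\![\phi]\!]_{\sigma,\Delta,x}$ true; $Q_1\times Q_2$ lists, for each $y$ of $[\![Q_1]\!]$ in order and each $z$ of $[\![Q_2]\!]$ in order, the merged map $y\cup z$ (keys disjoint); $Q_1\bowtie_\phi Q_2=\sigma_\phi(Q_1\times Q_2)$; $\cup$ is list concatenation; $Q_1-Q_2$ starts from $[\![Q_1]\!]$ and, for each element $y$ of $[\![Q_2]\!]$ in order, deletes the first occurrence of $y$ (if any). Predicates on a tuple $x$: $a\odot a'$ compares $x(a),x(a')$; $a\odot v$ compares $x(a)$ with $v[\sigma]$; $a\in Q$ holds iff $x(a)$ occurs in the list of first values of the tuples of $[\![Q]\!]_{\sigma,\Delta}$; connectives are standard. An invocation sequence is $\omega=(i_1,\sigma_1);\dots;(i_n,\sigma_n)$, $n\ge1$, where for $j<n$, $i_j$ is the index of an update transaction and $\sigma_j$ a valuation of its parameters, and $i_n$ is the index of a query transaction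 with valuation $\sigma_n$. $[\![P]\!]_{\omega,\Delta}$ is obtained by applying $U_{i_1}$ under $\sigma_1$ to $\Delta$, then $U_{i_2}$ under $\sigma_2$, etc., yielding $\Delta''$, and returning the list obtained by mapping each tuple of $[\![Q_{i_n}]\!]_{\sigma_n,\Delta''}$ to its list of values. $[\![P]\!]_\omega=[\![P]\!]_{\omega,\Delta_\emptyset}$ where $\Delta_\emptyset$ maps every relation to the empty list. Refinement: for each shared index $i$, the parameters $\vec x=(x_1,\dots,x_k)$ of the $i$-th transaction of $P$ correspond to the first $k$ parameters $y_1,\dots,y_k$ of the $i$-th transaction of $P'$ (which may have more parameters). A valuation $\sigma'$ refines $\sigma$, $\sigma'\preceq\sigma$, if $\sigma'$ gives every variable of $\mathrm{dom}(\sigma)$ (i.e. each $y_j$ corresponding to $x_j$) the same value as $\sigma$. For invocation sequences $\omega=(i_1,\sigma_1)\dots(i_n,\sigma_n)$ (valid for $P$) and $\omega'=(i'_1,\sigma'_1)\dots(i'_n,\sigma'_n)$ (valid for $P'$), $\omega'\preceq\omega$ iff $i_k=i'_k$ and $\sigma'_k\preceq\sigma_k$ for all $k\in[1,n]$. $P'\preceq P$ iff for all such $\omega,\omega'$ with $\omega'\preceq\omega$ there is an attribute list $L$ with $[\![\Pi_L(P')]\!]_{\omega'}=[\![P]\!]_\omega$, where $\Pi_L(P')$ replaces each query $Q'_i$ of $P'$ by $\Pi_L(Q'_i)$. A simulation invariant is a relation $\Phi$ between instances of $\mathcal{S}$ and of $\mathcal{S}'$. It is inductive if (a) $\Phi(\Delta_\emptyset,\Delta'_\emptyset)$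 and (b) for every $i\in[1,|\vec T_U|]$ the Hoare triple $\{\Phi\wedge\bigwedge_{x_j\in\vec x}x_j=y_j\}\,U_i;U_i'\,\{\Phi\}$ is valid (with $\vec x$ the parameters of $U_i$, $\vec y$ those of $U'_i$). It is projectively sufficient if for every $i\in[1,|\vec T_Q|]$, $(\Phi\wedge\bigwedge_{x_j\in\vec x}x_j=y_j)\models\exists L.\ Q_i=\Pi_L(Q'_i)$, i.e. whenever $\Phi(\Delta,\Delta')$ and the valuations agree on corresponding parameters, there is an attribute list $L$ such that the value lists of $[\![Q_i]\!]$ on $\Delta$ and $[\![\Pi_L(Q'_i)]\!]$ on $\Delta'$ coincide. -}

module Defs where

open import Level using (0ℓ)
open import Data.Bool using (Bool; true; false; if_then_else_; _∧_; _∨_; not)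
open import Data.Nat using (ℕ; _≤_)
open import Data.Fin using (Fin; toℕ; inject≤)
open import Data.String using (String)
import Data.String as Str
open import Data.Maybe using (Maybe; just; nothing; maybe′)
open import Data.List using (List; []; _∷_; _++_; map; concatMap; foldl; length; lookup; mapMaybe; head)
open import Data.Bool.ListAction using (any)
open import Data.List.NonEmpty using (List⁺; toList)
open import Data.List.Relation.Binary.Pointwise using (Pointwise)
open import Data.Product using (Σ; _×_; _,_; proj₁; proj₂)
import Data.List.Properties as LP
import Data.Product.Properties as PP
open import Relation.Binary.Core using (Rel)
open import Relation.Binary.Definitions using (Decidable; DecidableEquality)
open import Relation.Binary.Structures using (IsTotalOrder)
open import Relation.Binary.PropositionalEquality using (_≡_)
open import Relation.Nullary.Decidable using (⌊_⌋)

record ValueDomain : Set₁ where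
  field
    Val          : Set
    Ty           : Set
    _≟_          : DecidableEquality Val
    _≤ᵥ_         : Rel Val 0ℓ
    _≤?_         : Decidable _≤ᵥ_
    isTotalOrder : IsTotalOrder _≡_ _≤ᵥ_

Attr : Set
Attr = String

RelName : Set
RelName = String

data CmpOp : Set where
  le lt eq ne gt ge : CmpOp

module Semantics (D : ValueDomain) where
  open ValueDomain D

  -- a tuple: finite map from attributes to values, viewed as a list of pairs
  Tuple : Set
  Tuple = List (Attr × Val)

  Instance : Set
  Instance = RelName → List Tuple

  emptyInst : Instance
  emptyInst = λ _ → []

  Valuation : ℕ → Set
  Valuation n = Fin n → Val

  data Term (n : ℕ) : Set where
    var   : Fin n → Term n
    const : Val → Term n

  mutual
    data Query (n : ℕ) : Set where
      rel   : RelName → Query n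
      proj  : List⁺ Attr → Query n → Query n
      sel   : Pred n → Query n → Query n
      join  : Pred n → Query n → Query n → Query n
      union : Query n → Query n → Query n
      diff  : Query n → Query n → Query n

    data Pred (n : ℕ) : Set where
      cmpAA : Attr → CmpOp → Attr → Pred n
      cmpAV : Attr → CmpOp → Term n → Pred n
      mem   : Attr → Query n → Pred n
      and   : Pred n → Pred n → Pred n
      or    : Pred n → Pred n → Pred n
      neg   : Pred n → Pred n

  data Update (n : ℕ) : Set where
    ins : RelName → List (Attr × Term n) → Update n
    del : RelName → Pred n → Update n
    upd : RelName → Pred n → Attr → Term n → Update n
    seq : Update n → Update n → Update n

  termVal : ∀ {n} → Valuation n → Term n → Val
  termVal σ (var j)   = σ j
  termVal σ (const v) = v

  cmp : CmpOp → Val → Val → Bool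
  cmp le x y = ⌊ x ≤? y ⌋
  cmp lt x y = ⌊ x ≤? y ⌋ ∧ not ⌊ x ≟ y ⌋
  cmp eq x y = ⌊ x ≟ y ⌋
  cmp ne x y = not ⌊ x ≟ y ⌋
  cmp gt x y = not ⌊ x ≤? y ⌋
  cmp ge x y = not ⌊ x ≤? y ⌋ ∨ ⌊ x ≟ y ⌋

  cmpM : CmpOp → Maybe Val → Maybe Val → Bool
  cmpM o (just x) (just y) = cmp o x y
  cmpM o _        _        = false

  lookupA : Tuple → Attr → Maybe Val
  lookupA []              a = nothing
  lookupA ((b , v) ∷ t) a = if ⌊ b Str.≟ a ⌋ then just v else lookupA t a

  filterB : {A : Set} → (A → Bool) → List A → List A
  filterB p []       = []
  filterB p (x ∷ xs) = if p x then x ∷ filterB p xs else filterB p xs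

  memAttr : Attr → List Attr → Bool
  memAttr a as = any (λ b → ⌊ a Str.≟ b ⌋) as

  restrict : List⁺ Attr → Tuple → Tuple
  restrict ψ t = filterB (λ p → memAttr (proj₁ p) (toList ψ)) t

  -- Q1 × Q2 : merged maps y ∪ z in nested order
  cartesian : List Tuple → List Tuple → List Tuple
  cartesian xs ys = concatMap (λ y → map (λ z → y ++ z) ys) xs

  tupleEq : DecidableEquality Tuple
  tupleEq = LP.≡-dec (PP.≡-dec Str._≟_ _≟_)

  deleteFirst : Tuple → List Tuple → List Tuple
  deleteFirst y []       = []
  deleteFirst y (x ∷ xs) = if ⌊ tupleEq x y ⌋ then xs else x ∷ deleteFirst y xs

  minus : List Tuple → List Tuple → List Tuple
  minus xs ys = foldl (λ acc y → deleteFirst y acc) xs ys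

  values : Tuple → List Val
  values t = map proj₂ t

  firstVals : List Tuple → List Val
  firstVals ts = mapMaybe (λ t → head (values t)) ts

  memVal : Val → List Val → Bool
  memVal v vs = any (λ w → ⌊ v ≟ w ⌋) vs

  mutual
    evalQ : ∀ {n} → Query n → Valuation n → Instance → List Tuple
    evalQ (rel R)       σ Δ = Δ R
    evalQ (proj ψ q)    σ Δ = map (restrict ψ) (evalQ q σ Δ)
    evalQ (sel φ q)     σ Δ = filterB (evalP φ σ Δ) (evalQ q σ Δ)
    evalQ (join φ q r)  σ Δ = filterB (evalP φ σ Δ) (cartesian (evalQ q σ Δ) (evalQ r σ Δ))
    evalQ (union q r)   σ Δ = evalQ q σ Δ ++ evalQ r σ Δ
    evalQ (diff q r)    σ Δ = minus (evalQ q σ Δ) (evalQ r σ Δ)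

    evalP : ∀ {n} → Pred n → Valuation n → Instance → Tuple → Bool
    evalP (cmpAA a o b) σ Δ x = cmpM o (lookupA x a) (lookupA x b)
    evalP (cmpAV a o v) σ Δ x = cmpM o (lookupA x a) (just (termVal σ v))
    evalP (mem a q)     σ Δ x = maybe′ (λ v → memVal v (firstVals (evalQ q σ Δ))) false (lookupA x a)
    evalP (and φ ψ)     σ Δ x = evalP φ σ Δ x ∧ evalP ψ σ Δ x
    evalP (or φ ψ)      σ Δ x = evalP φ σ Δ x ∨ evalP ψ σ Δ x
    evalP (neg φ)       σ Δ x = not (evalP φ σ Δ x)

  setRel : Instance → RelName → List Tuple → Instance
  setRel Δ R l = λ R' → if ⌊ R' Str.≟ R ⌋ then l else Δ R'

  setAttr : Attr → Val → Tuple → Tuple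
  setAttr a v t = map (λ p → if ⌊ proj₁ p Str.≟ a ⌋ then (proj₁ p , v) else p) t

  execU : ∀ {n} → Update n → Valuation n → Instance → Instance
  execU (ins R fs)    σ Δ = setRel Δ R (Δ R ++ (map (λ p → (proj₁ p , termVal σ (proj₂ p))) fs ∷ []))
  execU (del R φ)     σ Δ = setRel Δ R (filterB (λ x → not (evalP φ σ Δ x)) (Δ R))
  execU (upd R φ a v) σ Δ =
    setRel Δ R (filterB (λ x → not (evalP φ σ Δ x)) (Δ R)
                ++ map (setAttr a (termVal σ v)) (filterB (evalP φ σ Δ) (Δ R)))
  execU (seq u₁ u₂)   σ Δ = execU u₂ σ (execU u₁ σ Δ)

  Schema : Set
  Schema = List (RelName × List (Attr × Ty))

  record UTx : Set where
    field
      arity : ℕ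
      body  : Update arity

  record QTx : Set where
    field
      arity : ℕ
      body  : Query arity

  record Program : Set where
    field
      schema  : Schema
      updates : List UTx
      queries : List QTx

  open Program public

  uTx : (P : Program) → Fin (length (updates P)) → UTx
  uTx P i = lookup (updates P) i

  qTx : (P : Program) → Fin (length (queries P)) → QTx
  qTx P i = lookup (queries P) i

  UCall : Program → Set
  UCall P = Σ (Fin (length (updates P))) λ i → Valuation (UTx.arity (uTx P i))

  QCall : Program → Set
  QCall P = Σ (Fin (length (queries P))) λ i → Valuation (QTx.arity (qTx P i))

  Invocation : Program → Set
  Invocation P = List (UCall P) × QCall P

  runUpdates : (P : Program) → List (UCall P) → Instance → Instance
  runUpdates P []              Δ = Δ
  runUpdates P ((i , σ) ∷ us) Δ = runUpdates P us (execU (UTx.body (uTx P i)) σ Δ)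

  run : (P : Program) → Invocation P → List (List Val)
  run P (us , (i , σ)) = map values (evalQ (QTx.body (qTx P i)) σ (runUpdates P us emptyInst))

  runProj : List⁺ Attr → (P : Program) → Invocation P → List (List Val)
  runProj L P (us , (i , σ)) =
    map values (evalQ (proj L (QTx.body (qTx P i))) σ (runUpdates P us emptyInst))

  Refines : ∀ {k k'} → Valuation k' → Valuation k → Set
  Refines {k} {k'} σ' σ = (j : Fin k) → Σ (Fin k') λ j' → toℕ j' ≡ toℕ j × σ' j' ≡ σ j

  UCallRefines : {P P' : Program} → UCall P' → UCall P → Set
  UCallRefines (i' , σ') (i , σ) = toℕ i' ≡ toℕ i × Refines σ' σ

  QCallRefines : {P P' : Program} → QCall P' → QCall P → Set
  QCallRefines (i' , σ') (i , σ) = toℕ i' ≡ toℕ i × Refines σ' σ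

  InvRefines : {P P' : Program} → Invocation P' → Invocation P → Set
  InvRefines {P} {P'} (us' , q') (us , q) =
    Pointwise (UCallRefines {P} {P'}) us' us × QCallRefines {P} {P'} q' q

  _⪯_ : Program → Program → Set
  P' ⪯ P = (ω : Invocation P) (ω' : Invocation P') → InvRefines {P} {P'} ω' ω →
           Σ (List⁺ Attr) λ L → runProj L P' ω' ≡ run P ω

  SimInv : Set₁
  SimInv = Instance → Instance → Set

  Inductive : (P P' : Program) → length (updates P) ≤ length (updates P') → SimInv → Set
  Inductive P P' hU Φ =
    Φ emptyInst emptyInst ×
    ((i : Fin (length (updates P))) →
      (σ : Valuation (UTx.arity (uTx P i))) →
      (σ' : Valuation (UTx.arity (uTx P' (inject≤ i hU)))) →
      (Δ Δ' : Instance) →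
      Φ Δ Δ' → Refines σ' σ →
      Φ (execU (UTx.body (uTx P i)) σ Δ) (execU (UTx.body (uTx P' (inject≤ i hU))) σ' Δ'))

  ProjSufficient : (P P' : Program) → length (queries P) ≤ length (queries P') → SimInv → Set
  ProjSufficient P P' hQ Φ =
    (i : Fin (length (queries P))) →
    (σ : Valuation (QTx.arity (qTx P i))) →
    (σ' : Valuation (QTx.arity (qTx P' (inject≤ i hQ)))) →
    (Δ Δ' : Instance) →
    Φ Δ Δ' → Refines σ' σ →
    Σ (List⁺ Attr) λ L →
      map values (evalQ (QTx.body (qTx P i)) σ Δ)
        ≡ map values (evalQ (proj L (QTx.body (qTx P' (inject≤ i hQ)))) σ' Δ')

module Submission where

open import Defs
open import Data.Nat using (_≤_)
open import Data.List using (length; List; []; _∷_; map)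
open import Data.List.NonEmpty using (List⁺)
open import Data.Product using (Σ; _×_; _,_; proj₁; proj₂; map₂)
open import Data.Fin using (Fin; toℕ; inject≤)
open import Data.Fin.Properties using (toℕ-inject≤; toℕ-injective)
open import Data.List.Relation.Binary.Pointwise using (Pointwise; []; _∷_)
open import Relation.Binary.PropositionalEquality using (_≡_; refl; sym; trans)

-- An invariant that holds initially and is preserved by every pair of
-- corresponding update transactions holds after any pair of corresponding
-- update sequences; projective sufficiency then equates the final queries.

toℕ-≡⇒≡-inject≤ : ∀ {m n} (m≤n : m ≤ n) {i : Fin m} {i' : Fin n} →
                  toℕ i' ≡ toℕ i → i' ≡ inject≤ i m≤n
toℕ-≡⇒≡-inject≤ m≤n {i} i'≡i = toℕ-injective (trans i'≡i (sym (toℕ-inject≤ i m≤n)))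

module _ (D : ValueDomain) where
  open ValueDomain D using (Val)
  open Semantics D

  module _ {P P' : Program} (hU : length (updates P) ≤ length (updates P'))
           {Φ : SimInv} (ind : Inductive P P' hU Φ) where

    Φ-preserved-by-call : (c : UCall P) (c' : UCall P') → UCallRefines {P} {P'} c' c →
                          ∀ {Δ Δ'} → Φ Δ Δ' →
                          Φ (runUpdates P (c ∷ []) Δ) (runUpdates P' (c' ∷ []) Δ')
    Φ-preserved-by-call (i , σ) (i' , σ') (i'≡i , σ'⪯σ) {Δ} {Δ'} Φ[Δ,Δ'] =
      step i' (toℕ-≡⇒≡-inject≤ hU i'≡i) σ' σ'⪯σ
      where
        -- Matching on i' ≡ inject≤ i hU aligns the transaction of P' with the
        -- one the inductiveness hypothesis speaks about.
        step : (i' : Fin (length (updates P'))) → i' ≡ inject≤ i hU →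
               (σ' : Valuation (UTx.arity (uTx P' i'))) → Refines σ' σ →
               Φ (execU (UTx.body (uTx P i)) σ Δ) (execU (UTx.body (uTx P' i')) σ' Δ')
        step .(inject≤ i hU) refl σ' = proj₂ ind i σ σ' Δ Δ' Φ[Δ,Δ']

    Φ-preserved-by-runUpdates : (us : List (UCall P)) (us' : List (UCall P')) →
                                Pointwise (UCallRefines {P} {P'}) us' us →
                                ∀ {Δ Δ'} → Φ Δ Δ' →
                                Φ (runUpdates P us Δ) (runUpdates P' us' Δ')
    Φ-preserved-by-runUpdates [] [] [] Φ[Δ,Δ'] = Φ[Δ,Δ']
    Φ-preserved-by-runUpdates (c ∷ us) (c' ∷ us') (c'⪯c ∷ us'⪯us) Φ[Δ,Δ'] =
      Φ-preserved-by-runUpdates us us' us'⪯us (Φ-preserved-by-call c c' c'⪯c Φ[Δ,Δ'])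

  answer : (P : Program) → QCall P → Instance → List (List Val)
  answer P (i , σ) Δ = map values (evalQ (QTx.body (qTx P i)) σ Δ)

  answerProj : List⁺ Attr → (P : Program) → QCall P → Instance → List (List Val)
  answerProj L P (i , σ) Δ = map values (evalQ (proj L (QTx.body (qTx P i))) σ Δ)

  sufficient-answer : {P P' : Program} (hQ : length (queries P) ≤ length (queries P'))
                      {Φ : SimInv} → ProjSufficient P P' hQ Φ →
                      (q : QCall P) (q' : QCall P') → QCallRefines {P} {P'} q' q →
                      ∀ {Δ Δ'} → Φ Δ Δ' →
                      Σ (List⁺ Attr) λ L → answerProj L P' q' Δ' ≡ answer P q Δ
  sufficient-answer {P} {P'} hQ suff (i , σ) (i' , σ') (i'≡i , σ'⪯σ) {Δ} {Δ'} Φ[Δ,Δ'] =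
    agree i' (toℕ-≡⇒≡-inject≤ hQ i'≡i) σ' σ'⪯σ
    where
      agree : (i' : Fin (length (queries P'))) → i' ≡ inject≤ i hQ →
              (σ' : Valuation (QTx.arity (qTx P' i'))) → Refines σ' σ →
              Σ (List⁺ Attr) λ L → answerProj L P' (i' , σ') Δ' ≡ answer P (i , σ) Δ
      agree .(inject≤ i hQ) refl σ' σ'⪯σ = map₂ sym (suff i σ σ' Δ Δ' Φ[Δ,Δ'] σ'⪯σ)

theorem4p7 : (D : ValueDomain) → let open Semantics D in
    (P P' : Program) →
    (hU : length (updates P) ≤ length (updates P')) →
    (hQ : length (queries P) ≤ length (queries P')) →
    Σ SimInv (λ Φ → Inductive P P' hU Φ × ProjSufficient P P' hQ Φ) →
    P' ⪯ P
-- The query calls are taken apart so that run and runProj unfold.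
theorem4p7 D P P' hU hQ (Φ , ind , suff) (us , q@(_ , _)) (us' , q'@(_ , _)) (us'⪯us , q'⪯q) =
  sufficient-answer D {P} {P'} hQ suff q q' q'⪯q
    (Φ-preserved-by-runUpdates D {P} {P'} hU ind us us' us'⪯us (proj₁ ind))
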